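{- Let $\mathcal{M}=(Q,\Gamma,\Delta,q_0,\gamma_0)$ be a DCFS with $\Gamma=\{\gamma_0,\ldots,\gamma_n\}$, and let $m=n+2$. Let $\mathcal{V}=(m,P,\Delta,\delta,(q_0,\bot),\mathbf{u}_0)$ be the VASS with states $P=(Q\times(\Gamma_\epsilon\cup\{\bot\}))\cup\{p_{halt}\}$ ($p_{halt}$ a fresh state), actions $\Delta$, $\mathbf{u}_0=(1,0,\ldots,0)$, and $\delta:P\times\Delta\to P\times[-1,1]^m$ defined for $p\in P$, $t\in\Delta$ by: $\delta(p,t)=((q',u),\mathbf{0})$ if $t=\langle q,\gamma\rangle\to\langle q',u\rangle\rhd\epsilon$ and $p=(q,\gamma)$; $\delta(p,t)=((q',u),\mathbf{e}_i)$ if $t=\langle q,\gamma\rangle\to\langle q',u\rangle\rhd\gamma_{i-1}$ with $i\in[1,m-1]$ and $p=(q,\gamma)$; $\delta(p,t)=((q',\bot),\mathbf{e}_j)$ if $t=\langle q,\gamma\rangle\mapsto\langle q',u\rangle$, $p=(q,\gamma)$, and $j=m$ when $u=\epsilon$, $j$ such that $u=\gamma_{j-1}$ when $u\in\Gamma$; $\delta(p,t)=((q',\gamma_{i-1}),-\mathbf{e}_i)$ if $t=q\mapsto q'\lhd\gamma_{i-1}$ with $i\in[1,m-1]$ and $p=(q,\bot)$; and $\delta(p,t)=(p_{halt},\mathbf{0})$ otherwise. (Here $\mathbf{0}$ is the zero vector and $\mathbf{e}_i$ the $i$-th unit vector of dimension $m$.) Then for every $q\in Q$: $q$ is reachable by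 $\mathcal{M}$ if and only if $(q,\bot)$ is reachable by $\mathcal{V}$.
   Context: A DCPS is a tuple $(Q,\Gamma,\Delta,q_0,\gamma_0)$: $Q$ finite non-empty set of states, $\Gamma$ finite stack alphabet, $q_0\in Q$, $\gamma_0\in\Gamma$, $\Delta$ consisting of creation rules $\langle q,\gamma\rangle\to\langle q',u\rangle\rhd\alpha$ ($u\in\Gamma^{\le 2}=\Gamma_\epsilon\cup\Gamma^2$, $\alpha\in\Gamma_\epsilon=\Gamma\cup\{\epsilon\}$), interruption rules $\langle q,\gamma\rangle\mapsto\langle q',u\rangle$, and resumption rules $q\mapsto q'\lhd\gamma$. A DCFS is a DCPS in which every creation and interruption rule has $|u|\le1$. Local configurations are $(w,i)\in\Gamma^*\times\mathbb{N}$ (set $\mathit{Loc}$); configurations are $(q,\eta,\mathit{Val})$ with $q\in Q$, $\eta\in\mathit{Loc}\cup\{\bot\}$, $\mathit{Val}:\mathit{Loc}\to\mathbb{N}$; $\mathbf{1}_x$ maps $x$ to $1$, all else to $0$. Initial configuration $(q_0,\bot,\mathbf{1}_{(\gamma_0,0)})$. Steps: creation $(q,(\gamma w,i),\mathit{Val})\to(q',(uw,i),\mathit{Val}')$ with $\mathit{Val}'=\mathit{Val}+\mathbf{1}_{(\alpha,i+1)}$ if $\alpha\in\Gamma$, else $\mathit{Val}'=\mathit{Val}$; interruption $(q,(\gamma w,i),\mathit{Val})\to(q',\bot,\mathit{Val}+\mathbf{1}_{(uw,i+1)})$; resumption $(q,\bot,\mathit{Val}+\mathbf{1}_{(\gamma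 w,i)})\to(q',(\gamma w,i),\mathit{Val})$. A state $q$ is reachable by the DCPS if some configuration with no active thread and state $q$ is reachable from the initial configuration. A VASS $(m,P,\Sigma,\delta,p_0,\mathbf{u}_0)$ has configurations $(p,\mathbf{u})\in P\times\mathbb{N}^m$ with $(p_1,\mathbf{u}_1)\xrightarrow{a}(p_2,\mathbf{u}_2)$ iff $\delta(p_1,a)=(p_2,\mathbf{u}_2-\mathbf{u}_1)$; a state $p$ is reachable by the VASS if some configuration with state $p$ is reachable from $(p_0,\mathbf{u}_0)$. -}

module Defs where

open import Data.Nat as ℕ using (ℕ; zero; suc; _≤_)
open import Data.Fin as Fin using (Fin; inject₁; fromℕ)
open import Data.Integer as ℤ using (ℤ; +_; -_; _-_)
open import Data.List using (List; []; _∷_; _++_; length)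
open import Data.List.Relation.Unary.All using (All)
open import Data.List.Membership.Propositional using (_∈_)
open import Data.Maybe using (Maybe; just; nothing)
open import Data.Product using (Σ; ∃; _×_; _,_; proj₁; proj₂)
open import Data.Bool using (Bool; if_then_else_; _∧_)
open import Relation.Nullary using (does)
open import Relation.Binary.PropositionalEquality using (_≡_)
open import Relation.Binary.Definitions using (DecidableEquality)
import Data.List.Properties as ListP
import Data.Product.Properties as ProdP
open import Relation.Binary.Construct.Closure.ReflexiveTransitive using (Star)

-- Rules.  Γ_ε is Maybe Γ; words u ∈ Γ^{≤2} are lists (length bound in wf).
data Rule (k g : ℕ) : Set where
  create    : (q : Fin k) (γ : Fin g) (q' : Fin k) (u : List (Fin g)) (α : Maybe (Fin g)) → Rule k g
  interrupt : (q : Fin k) (γ : Fin g) (q' : Fin k) (u : List (Fin g)) → Rule k g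
  resume    : (q q' : Fin k) (γ : Fin g) → Rule k g

RuleBound : ∀ {k g} → ℕ → Rule k g → Set
RuleBound b (create _ _ _ u _)  = length u ≤ b
RuleBound b (interrupt _ _ _ u) = length u ≤ b
RuleBound b (resume _ _ _)      = Data.Unit.⊤
  where import Data.Unit

record DCPS (k g : ℕ) : Set where
  field
    Δ  : List (Rule k g)
    q₀ : Fin k
    γ₀ : Fin g
    Δ-wf : All (RuleBound 2) Δ
open DCPS public

IsDCFS : ∀ {k g} → DCPS k g → Set
IsDCFS M = All (RuleBound 1) (Δ M)

Loc : ℕ → Set
Loc g = List (Fin g) × ℕ

_≟Loc_ : ∀ {g} → DecidableEquality (Loc g)
_≟Loc_ = ProdP.≡-dec (ListP.≡-dec Fin._≟_) ℕ._≟_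

𝟏 : ∀ {g} → Loc g → Loc g → ℕ
𝟏 x y = if does (x ≟Loc y) then 1 else 0

created : ∀ {g} → Maybe (Fin g) → ℕ → Loc g → ℕ
created nothing  i y = 0
created (just a) i y = 𝟏 (a ∷ [] , suc i) y

-- configurations (q, η, Val); η = nothing stands for ⊥
Config : ℕ → ℕ → Set
Config k g = Fin k × Maybe (Loc g) × (Loc g → ℕ)

-- one step, via a rule t ∈ Δ (multiset equations stated pointwise)
data Step {k g : ℕ} (M : DCPS k g) : Config k g → Config k g → Set where
  create-step : ∀ {q γ q' u α w i Val Val'} →
    create q γ q' u α ∈ Δ M →
    (∀ y → Val' y ≡ Val y ℕ.+ created α i y) →
    Step M (q , just (γ ∷ w , i) , Val) (q' , just (u ++ w , i) , Val')
  interrupt-step : ∀ {q γ q' u w i Val Val'} →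
    interrupt q γ q' u ∈ Δ M →
    (∀ y → Val' y ≡ Val y ℕ.+ 𝟏 (u ++ w , suc i) y) →
    Step M (q , just (γ ∷ w , i) , Val) (q' , nothing , Val')
  resume-step : ∀ {q q' γ w i Val Val'} →
    resume q q' γ ∈ Δ M →
    (∀ y → Val y ≡ Val' y ℕ.+ 𝟏 (γ ∷ w , i) y) →
    Step M (q , nothing , Val) (q' , just (γ ∷ w , i) , Val')

initConfig : ∀ {k g} → DCPS k g → Config k g
initConfig M = q₀ M , nothing , 𝟏 (γ₀ M ∷ [] , 0)

DCPSReachable : ∀ {k g} → DCPS k g → Fin k → Set
DCPSReachable M q = ∃ λ Val → Star (Step M) (initConfig M) (q , nothing , Val)

record VASS : Set₁ where
  field
    m  : ℕ
    P  : Set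
    Act : Set
    δ  : P → Act → P × (Fin m → ℤ)
    p₀ : P
    u₀ : Fin m → ℕ

module _ (V : VASS) where
  open VASS V

  VStep : P × (Fin m → ℕ) → P × (Fin m → ℕ) → Set
  VStep (p₁ , u₁) (p₂ , u₂) = ∃ λ a →
    proj₁ (δ p₁ a) ≡ p₂ × (∀ i → proj₂ (δ p₁ a) i ≡ + u₂ i - + u₁ i)

  VASSReachable : P → Set
  VASSReachable p = ∃ λ u → Star VStep (p₀ , u₀) (p , u)

-- The VASS simulating a DCFS with Γ = {γ₀,…,γₙ} = Fin (suc n), m = n+2.
-- Counter index i ∈ [1,m] is represented by Fin m element i-1.

data Top (g : ℕ) : Set where
  sym : Fin g → Top g
  eps : Top g
  bot : Top g

data PState (k g : ℕ) : Set where
  ⟨_,_⟩ : Fin k → Top g → PState k g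
  halt  : PState k g

-- u ∈ Γ_ε (|u| ≤ 1 in a DCFS) as an element of Γ_ε
asΓε : ∀ {g} → List (Fin g) → Top g
asΓε []      = eps
asΓε (a ∷ _) = sym a

𝟎 : ∀ {m} → Fin m → ℤ
𝟎 _ = + 0

𝐞 : ∀ {m} → Fin m → Fin m → ℤ
𝐞 j i = if does (j Fin.≟ i) then + 1 else + 0

-- counter for a thread whose stack is u: γ_{j-1} ↦ j, ε ↦ m
counterOf : ∀ {n} → List (Fin (suc n)) → Fin (suc (suc n))
counterOf {n} []      = fromℕ (suc n)
counterOf     (a ∷ _) = inject₁ a

dispOf : ∀ {n} → Maybe (Fin (suc n)) → Fin (suc (suc n)) → ℤ
dispOf nothing  = 𝟎
dispOf (just a) = 𝐞 (inject₁ a)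

δM : ∀ {k n} → PState k (suc n) → Rule k (suc n) → PState k (suc n) × (Fin (suc (suc n)) → ℤ)
δM ⟨ p , sym γ' ⟩ (create q γ q' u α) =
  if does (p Fin.≟ q) ∧ does (γ' Fin.≟ γ) then (⟨ q' , asΓε u ⟩ , dispOf α) else (halt , 𝟎)
δM ⟨ p , sym γ' ⟩ (interrupt q γ q' u) =
  if does (p Fin.≟ q) ∧ does (γ' Fin.≟ γ) then (⟨ q' , bot ⟩ , 𝐞 (counterOf u)) else (halt , 𝟎)
δM ⟨ p , bot ⟩ (resume q q' γ) =
  if does (p Fin.≟ q) then (⟨ q' , sym γ ⟩ , λ i → - 𝐞 (inject₁ γ) i) else (halt , 𝟎)
δM _ _ = halt , 𝟎

𝐮₀ : ∀ {n} → Fin (suc (suc n)) → ℕ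
𝐮₀ i = if does (i Fin.≟ Fin.zero) then 1 else 0

VASSof : ∀ {k n} → DCPS k (suc n) → VASS
VASSof {k} {n} M = record
  { m   = suc (suc n)
  ; P   = PState k (suc n)
  ; Act = Σ (Rule k (suc n)) (λ t → t ∈ Δ M)
  ; δ   = λ p t → δM p (proj₁ t)
  ; p₀  = ⟨ q₀ M , bot ⟩
  ; u₀  = 𝐮₀
  }

module Submission where

open import Defs
open import Data.Nat using (ℕ; suc)
open import Data.Fin using (Fin; zero)
open import Relation.Binary.PropositionalEquality using (_≡_)
open import Function.Bundles using (_⇔_)

open import Data.Nat using (_+_; _≤_; s≤s)
import Data.Nat.Properties as ℕ
open import Data.Fin using (inject₁)
import Data.Fin as Fin
import Data.Fin.Properties as Fin
open import Data.Integer using (ℤ; +_; -_; _-_)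
import Data.Integer as ℤ
import Data.Integer.Properties as ℤ
open import Data.Integer.Tactic.RingSolver using (solve-∀)
open import Data.List using (List; []; _∷_; _++_; length)
open import Data.List.Relation.Unary.All as All using ()
open import Data.List.Relation.Unary.Any as Any using (Any; here; there; _─_)
open import Data.List.Relation.Unary.Any.Properties using (lookup-result)
open import Data.List.Membership.Propositional using (_∈_)
open import Data.Maybe using (Maybe; just; nothing)
open import Data.Product using (Σ; _×_; _,_; proj₁; proj₂)
open import Data.Bool using (true; false; if_then_else_)
open import Data.Empty using (⊥-elim)
open import Relation.Nullary using (Dec; yes; no; does)
open import Relation.Nullary.Decidable using (dec-true)
import Relation.Binary.PropositionalEquality as ≡
open ≡ using (refl; trans; cong; _≢_)
open import Relation.Binary.Construct.Closure.ReflexiveTransitive using (Star; ε; _◅_)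
open import Function.Bundles using (mk⇔; module Equivalence)

-- The VASS V simulates the DCFS M step by step.  In a DCFS every
-- stack has length at most one, so a thread is determined by its optional top
-- symbol and its level.  The control state of V records the state of M together
-- with the top of the active thread (or ⊥ if no thread is active), and counter
-- j ∈ [1,m-1] counts the pending threads with top symbol γ_{j-1}; counter m
-- counts pending threads with empty stack, which can never be resumed.
--
-- Lemma 3.5 follows because the initial configurations are
-- related and p_halt is a trap.

⟦_⟧ : ∀ {P : Set} → Dec P → ℕ
⟦ d ⟧ = if does d then 1 else 0

⟦⟧-holds : ∀ {P : Set} (d : Dec P) → P → ⟦ d ⟧ ≡ 1
⟦⟧-holds d p rewrite dec-true d p = refl

⟦⟧-nonzero : ∀ {P : Set} (d : Dec P) → ⟦ d ⟧ ≢ 0 → P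
⟦⟧-nonzero (yes p) _       = p
⟦⟧-nonzero (no _)  ⟦d⟧≢0 = ⊥-elim (⟦d⟧≢0 refl)

plus-indicator-nonzero : ∀ {P : Set} {a b} (d : Dec P) → P → a ≡ b + ⟦ d ⟧ → a ≢ 0
plus-indicator-nonzero {b = b} d p a≡b+⟦d⟧ a≡0 =
  ℕ.1+n≢0 (trans (≡.sym (⟦⟧-holds d p))
                 (ℕ.m+n≡0⇒n≡0 b (trans (≡.sym a≡b+⟦d⟧) a≡0)))

𝐞-indicator : ∀ {m} (j i : Fin m) → 𝐞 j i ≡ + ⟦ j Fin.≟ i ⟧
𝐞-indicator j i with does (j Fin.≟ i)
... | true  = refl
... | false = refl

total : ∀ {A : Set} → (A → ℕ) → List A → ℕ
total w []       = 0
total w (x ∷ xs) = w x + total w xs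

total-++ : ∀ {A : Set} (w : A → ℕ) xs ys → total w (xs ++ ys) ≡ total w xs + total w ys
total-++ w []       ys = refl
total-++ w (x ∷ xs) ys =
  trans (cong (λ z → w x + z) (total-++ w xs ys)) (≡.sym (ℕ.+-assoc (w x) _ _))

total-─ : ∀ {A : Set} {P : A → Set} (w : A → ℕ) {xs} (p : Any P xs) →
          total w xs ≡ total w (xs ─ p) + w (Any.lookup p)
total-─ w {x ∷ xs} (here _)  = ℕ.+-comm (w x) _
total-─ w {x ∷ xs} (there p) =
  trans (cong (λ z → w x + z) (total-─ w p)) (≡.sym (ℕ.+-assoc (w x) _ _))

total-nonzero : ∀ {A : Set} (w : A → ℕ) xs → total w xs ≢ 0 → Any (λ x → w x ≢ 0) xs
total-nonzero w []       total≢0 = ⊥-elim (total≢0 refl)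
total-nonzero w (x ∷ xs) total≢0 with w x ℕ.≟ 0
... | no  wx≢0 = here wx≢0
... | yes wx≡0 = there (total-nonzero w xs λ rest≡0 → total≢0 (≡.cong₂ _+_ wx≡0 rest≡0))

-- A VASS step with displacement d leads from counters u to u'.  (A record, so
-- that u and u' can be inferred from it.)
record Moves {I : Set} (d : I → ℤ) (u u' : I → ℕ) : Set where
  constructor moves
  field displacement : ∀ j → d j ≡ + u' j - + u j
open Moves

increment⇔ : ∀ a b x → (x ≡ a + b) ⇔ (+ b ≡ + x - + a)
increment⇔ a b x = mk⇔ to from
  where
  cancel : ∀ (y z : ℤ) → z ≡ (y ℤ.+ z) - y
  cancel = solve-∀
  split : ∀ (y z : ℤ) → y ≡ z ℤ.+ (y - z)
  split = solve-∀
  to : x ≡ a + b → + b ≡ + x - + a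
  to refl = trans (cancel (+ a) (+ b)) (cong (_- + a) (≡.sym (ℤ.pos-+ a b)))
  from : + b ≡ + x - + a → x ≡ a + b
  from b≡x-a = ℤ.+-injective (trans (split (+ x) (+ a))
                 (trans (cong (λ z → + a ℤ.+ z) (≡.sym b≡x-a)) (≡.sym (ℤ.pos-+ a b))))

decrement⇔ : ∀ a b x → (a ≡ x + b) ⇔ (- + b ≡ + x - + a)
decrement⇔ a b x = mk⇔ to from
  where
  neg-diff : ∀ (y z : ℤ) → - (y - z) ≡ z - y
  neg-diff = solve-∀
  to : a ≡ x + b → - + b ≡ + x - + a
  to a≡x+b = trans (cong -_ (Equivalence.to (increment⇔ x b a) a≡x+b)) (neg-diff (+ a) (+ x))
  from : - + b ≡ + x - + a → a ≡ x + b
  from -b≡x-a = Equivalence.from (increment⇔ x b a)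
    (trans (≡.sym (ℤ.neg-involutive (+ b))) (trans (cong -_ -b≡x-a) (neg-diff (+ x) (+ a))))

moves-up : ∀ {I : Set} {d : I → ℤ} {u u'} (δ : I → ℕ) → (∀ j → d j ≡ + δ j) →
           (∀ j → u' j ≡ u j + δ j) ⇔ Moves d u u'
moves-up δ d≡δ = mk⇔
  (λ u'≡u+δ → moves λ j → trans (d≡δ j) (Equivalence.to (increment⇔ _ _ _) (u'≡u+δ j)))
  (λ m j → Equivalence.from (increment⇔ _ _ _) (trans (≡.sym (d≡δ j)) (displacement m j)))

moves-down : ∀ {I : Set} {d : I → ℤ} {u u'} (δ : I → ℕ) → (∀ j → d j ≡ - + δ j) →
             (∀ j → u j ≡ u' j + δ j) ⇔ Moves d u u'
moves-down δ d≡-δ = mk⇔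
  (λ u≡u'+δ → moves λ j → trans (d≡-δ j) (Equivalence.to (decrement⇔ _ _ _) (u≡u'+δ j)))
  (λ m j → Equivalence.from (decrement⇔ _ _ _) (trans (≡.sym (d≡-δ j)) (displacement m j)))

simulate-forward : ∀ {A B : Set} {S : A → A → Set} {T : B → B → Set} (R : A → B → Set) →
  (∀ {a a' b} → S a a' → R a b → Σ B λ b' → T b b' × R a' b') →
  ∀ {a a' b} → Star S a a' → R a b → Σ B λ b' → Star T b b' × R a' b'
simulate-forward R sim ε       r = _ , ε , r
simulate-forward R sim (s ◅ ss) r with sim s r
... | b₁ , t , r₁ with simulate-forward R sim ss r₁
...   | b₂ , ts , r₂ = b₂ , t ◅ ts , r₂

live-along : ∀ {B : Set} {T : B → B → Set} (Live : B → Set) →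
  (∀ {b b'} → T b b' → Live b' → Live b) → ∀ {b b'} → Star T b b' → Live b' → Live b
live-along Live back ε        live = live
live-along Live back (t ◅ ts) live = back t (live-along Live back ts live)

simulate-backward : ∀ {A B : Set} {S : A → A → Set} {T : B → B → Set}
  (R : A → B → Set) (Live : B → Set) → (∀ {b b'} → T b b' → Live b' → Live b) →
  (∀ {a b b'} → R a b → T b b' → Live b' → Σ A λ a' → S a a' × R a' b') →
  ∀ {a b b'} → R a b → Star T b b' → Live b' → Σ A λ a' → Star S a a' × R a' b'
simulate-backward R Live back sim r ε        live = _ , ε , r
simulate-backward R Live back sim r (t ◅ ts) live
  with sim r t (live-along Live back ts live)
... | a₁ , s , r₁ with simulate-backward R Live back sim r₁ ts live
...   | a₂ , ss , r₂ = a₂ , s ◅ ss , r₂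

module Simulation {k n : ℕ} (M : DCPS k (suc n)) (dcfs : IsDCFS M) where

  -- Stack symbols, and counters of V (Counter element j-1 stands for counter j).
  Sym : Set
  Sym = Fin (suc n)

  Counter : Set
  Counter = Fin (suc (suc n))

  -- A pending thread of a DCFS: its stack (of length ≤ 1) as an optional top
  -- symbol, and its level.
  Thread : Set
  Thread = Maybe Sym × ℕ

  locOf : Thread → Loc (suc n)
  locOf (nothing , i) = [] , i
  locOf (just γ  , i) = γ ∷ [] , i

  counterOfThread : Thread → Counter
  counterOfThread t = counterOf (proj₁ (locOf t))

  occ : List Thread → Loc (suc n) → ℕ
  occ L y = total (λ t → 𝟏 (locOf t) y) L

  cnt : List Thread → Counter → ℕ
  cnt L j = total (λ t → ⟦ counterOfThread t Fin.≟ j ⟧) L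

  record Pending (Val : Loc (suc n) → ℕ) (u : Counter → ℕ) : Set where
    constructor pending
    field
      threads : List Thread
      occ≗    : ∀ y → Val y ≡ occ threads y
      cnt≗    : ∀ j → u j ≡ cnt threads j
  open Pending

  record PendingWith (t : Thread) (Val : Loc (suc n) → ℕ) (u : Counter → ℕ) : Set where
    constructor pending-with
    field
      others    : List Thread
      occ-split : ∀ y → Val y ≡ occ others y + 𝟏 (locOf t) y
      cnt-split : ∀ j → u j ≡ cnt others j + ⟦ counterOfThread t Fin.≟ j ⟧

  pending-spawn : ∀ {Val u Val' u'} (N : List Thread) → Pending Val u →
    (∀ y → Val' y ≡ Val y + occ N y) → (∀ j → u' j ≡ u j + cnt N j) → Pending Val' u'
  pending-spawn N (pending L occ≗ cnt≗) Val'≡ u'≡ = pending (L ++ N)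
    (λ y → trans (Val'≡ y) (trans (cong (_+ occ N y) (occ≗ y)) (≡.sym (total-++ _ L N))))
    (λ j → trans (u'≡ j) (trans (cong (_+ cnt N j) (cnt≗ j)) (≡.sym (total-++ _ L N))))

  pending-─ : ∀ {Val u} {P : Thread → Set} (Π : Pending Val u) (p : Any P (threads Π)) →
              PendingWith (Any.lookup p) Val u
  pending-─ (pending L occ≗ cnt≗) p = pending-with (L ─ p)
    (λ y → trans (occ≗ y) (total-─ _ p))
    (λ j → trans (cnt≗ j) (total-─ _ p))

  pick-at : ∀ {Val u x} → Pending Val u → Val x ≢ 0 →
            Σ Thread λ t → locOf t ≡ x × PendingWith t Val u
  pick-at {x = x} Π Valx≢0 =
    Any.lookup p , ⟦⟧-nonzero (_ ≟Loc x) (lookup-result p) , pending-─ Π p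
    where
    p : Any (λ t → 𝟏 (locOf t) x ≢ 0) (threads Π)
    p = total-nonzero _ (threads Π) (λ occ≡0 → Valx≢0 (trans (occ≗ Π x) occ≡0))

  pick-counter : ∀ {Val u j} → Pending Val u → u j ≢ 0 →
                 Σ Thread λ t → counterOfThread t ≡ j × PendingWith t Val u
  pick-counter {j = j} Π uj≢0 =
    Any.lookup p , ⟦⟧-nonzero (_ Fin.≟ j) (lookup-result p) , pending-─ Π p
    where
    p : Any (λ t → ⟦ counterOfThread t Fin.≟ j ⟧ ≢ 0) (threads Π)
    p = total-nonzero _ (threads Π) (λ cnt≡0 → uj≢0 (trans (cnt≗ Π j) cnt≡0))

  data Active : Fin k → Maybe (Loc (suc n)) → PState k (suc n) → Set where
    idle      : ∀ {q}     → Active q nothing ⟨ q , bot ⟩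
    running-ε : ∀ {q i}   → Active q (just ([] , i)) ⟨ q , eps ⟩
    running-γ : ∀ {q γ i} → Active q (just (γ ∷ [] , i)) ⟨ q , sym γ ⟩

  VConfig : Set
  VConfig = PState k (suc n) × (Counter → ℕ)

  Sim : Config k (suc n) → VConfig → Set
  Sim (q , η , Val) (p , u) = Active q η p × Pending Val u

  data Short : List Sym → Set where
    short-ε : Short []
    short-γ : ∀ {γ} → Short (γ ∷ [])

  short : ∀ {u : List Sym} → length u ≤ 1 → Short u
  short {[]}          _        = short-ε
  short {_ ∷ []}      _        = short-γ
  short {_ ∷ _ ∷ _} (s≤s ())

  bounded : ∀ {t} → t ∈ Δ M → RuleBound 1 t
  bounded = All.lookup dcfs

  running : ∀ {q i} {u : List Sym} → Short u → Active q (just (u ++ [] , i)) ⟨ q , asΓε u ⟩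
  running short-ε = running-ε
  running short-γ = running-γ

  spawned : Maybe Sym → ℕ → List Thread
  spawned nothing  i = []
  spawned (just a) i = (just a , suc i) ∷ []

  occ-single : ∀ t y → 𝟏 (locOf t) y ≡ occ (t ∷ []) y
  occ-single t y = ≡.sym (ℕ.+-identityʳ _)

  cnt-single : ∀ t j → 𝐞 (counterOfThread t) j ≡ + cnt (t ∷ []) j
  cnt-single t j = trans (𝐞-indicator (counterOfThread t) j) (cong +_ (≡.sym (ℕ.+-identityʳ _)))

  spawned-occ : ∀ α i y → created α i y ≡ occ (spawned α i) y
  spawned-occ nothing  i y = refl
  spawned-occ (just a) i y = occ-single (just a , suc i) y

  spawned-cnt : ∀ α i j → dispOf α j ≡ + cnt (spawned α i) j
  spawned-cnt nothing  i j = refl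
  spawned-cnt (just a) i j = cnt-single (just a , suc i) j

  interrupted : ∀ {u} → Short u → ℕ → Thread
  interrupted short-ε       i = nothing , i
  interrupted (short-γ {γ}) i = just γ , i

  interrupted-occ : ∀ {u} (s : Short u) i y → 𝟏 (u ++ [] , i) y ≡ occ (interrupted s i ∷ []) y
  interrupted-occ short-ε       i y = occ-single (nothing , i) y
  interrupted-occ (short-γ {γ}) i y = occ-single (just γ , i) y

  interrupted-cnt : ∀ {u} (s : Short u) i j →
                    𝐞 (counterOf u) j ≡ + cnt (interrupted s i ∷ []) j
  interrupted-cnt short-ε       i j = cnt-single (nothing , i) j
  interrupted-cnt (short-γ {γ}) i j = cnt-single (just γ , i) j

  data Fires : PState k (suc n) → Rule k (suc n) →
               PState k (suc n) → (Counter → ℤ) → Set where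
    fire-create    : ∀ {q γ q' u α} →
      Fires ⟨ q , sym γ ⟩ (create q γ q' u α) ⟨ q' , asΓε u ⟩ (dispOf α)
    fire-interrupt : ∀ {q γ q' u} →
      Fires ⟨ q , sym γ ⟩ (interrupt q γ q' u) ⟨ q' , bot ⟩ (𝐞 (counterOf u))
    fire-resume    : ∀ {q q' γ} →
      Fires ⟨ q , bot ⟩ (resume q q' γ) ⟨ q' , sym γ ⟩ (λ j → - 𝐞 (inject₁ γ) j)

  fires⇒δM : ∀ {p t p' d} → Fires p t p' d → δM p t ≡ (p' , d)
  fires⇒δM (fire-create {q} {γ})
    rewrite dec-true (q Fin.≟ q) refl | dec-true (γ Fin.≟ γ) refl = refl
  fires⇒δM (fire-interrupt {q} {γ})
    rewrite dec-true (q Fin.≟ q) refl | dec-true (γ Fin.≟ γ) refl = refl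
  fires⇒δM (fire-resume {q}) rewrite dec-true (q Fin.≟ q) refl = refl

  δM⇒fires : ∀ p t → proj₁ (δM p t) ≢ halt →
             Fires p t (proj₁ (δM p t)) (proj₂ (δM p t))
  δM⇒fires ⟨ p , sym γ' ⟩ (create q γ q' u α) live with p Fin.≟ q | γ' Fin.≟ γ
  ... | yes refl | yes refl = fire-create
  ... | yes _    | no _     = ⊥-elim (live refl)
  ... | no _     | _        = ⊥-elim (live refl)
  δM⇒fires ⟨ p , sym γ' ⟩ (interrupt q γ q' u) live with p Fin.≟ q | γ' Fin.≟ γ
  ... | yes refl | yes refl = fire-interrupt
  ... | yes _    | no _     = ⊥-elim (live refl)
  ... | no _     | _        = ⊥-elim (live refl)
  δM⇒fires ⟨ p , bot ⟩ (resume q q' γ) live with p Fin.≟ q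
  ... | yes refl = fire-resume
  ... | no _     = ⊥-elim (live refl)
  δM⇒fires ⟨ _ , sym _ ⟩ (resume _ _ _)        live = ⊥-elim (live refl)
  δM⇒fires ⟨ _ , bot ⟩   (create _ _ _ _ _)    live = ⊥-elim (live refl)
  δM⇒fires ⟨ _ , bot ⟩   (interrupt _ _ _ _)   live = ⊥-elim (live refl)
  δM⇒fires ⟨ _ , eps ⟩   _                     live = ⊥-elim (live refl)
  δM⇒fires halt          _                     live = ⊥-elim (live refl)

  VS : VConfig → VConfig → Set
  VS = VStep (VASSof M)

  Live : VConfig → Set
  Live (p , _) = p ≢ halt

  halt-trap : ∀ {v v'} → VS v v' → Live v' → Live v
  halt-trap (_ , p'≡ , _) live refl = live (≡.sym p'≡)

  fire-step : ∀ {p t p' d u u'} → t ∈ Δ M → Fires p t p' d → Moves d u u' →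
              VS (p , u) (p' , u')
  fire-step mem fires (moves d≡u'-u) =
    (_ , mem) , cong proj₁ (fires⇒δM fires) ,
    λ j → trans (cong (λ r → proj₂ r j) (fires⇒δM fires)) (d≡u'-u j)

  data Firing (p : PState k (suc n)) (u : Counter → ℕ)
              (p' : PState k (suc n)) (u' : Counter → ℕ) : Set where
    firing : ∀ {t d} → t ∈ Δ M → Fires p t p' d → Moves d u u' → Firing p u p' u'

  step-firing : ∀ {p u p' u'} → VS (p , u) (p' , u') → p' ≢ halt → Firing p u p' u'
  step-firing {p} ((t , mem) , refl , d≡u'-u) live = firing mem (δM⇒fires p t live) (moves d≡u'-u)

  resume-disp : ∀ (γ : Sym) j → - 𝐞 (inject₁ γ) j ≡ - + ⟦ inject₁ γ Fin.≟ j ⟧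
  resume-disp γ j = cong -_ (𝐞-indicator (inject₁ γ) j)

  forward : ∀ {c c' v} → Step M c c' → Sim c v → Σ VConfig λ v' → VS v v' × Sim c' v'
  forward {v = _ , u} (create-step {u = w} {α} {i = i} {Val = Val} mem Val'≡) (running-γ , Π) =
    (_ , λ j → u j + cnt (spawned α i) j) ,
    fire-step mem fire-create (Equivalence.to (moves-up {u = u} _ (spawned-cnt α i)) λ j → refl) ,
    running (short {w} (bounded mem)) ,
    pending-spawn (spawned α i) Π
      (λ y → trans (Val'≡ y) (cong (λ z → Val y + z) (spawned-occ α i y))) (λ j → refl)
  forward {v = _ , u} (interrupt-step {u = w} {i = i} {Val = Val} mem Val'≡) (running-γ , Π) =
    (_ , λ j → u j + cnt (interrupted s (suc i) ∷ []) j) ,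
    fire-step mem fire-interrupt
      (Equivalence.to (moves-up {u = u} _ (interrupted-cnt s (suc i))) λ j → refl) ,
    idle ,
    pending-spawn (interrupted s (suc i) ∷ []) Π
      (λ y → trans (Val'≡ y) (cong (λ z → Val y + z) (interrupted-occ s (suc i) y))) (λ j → refl)
    where
    s : Short w
    s = short (bounded mem)
  -- The resumed location x is occupied, so it is that of a pending thread; as
  -- pending stacks are short, x = (γ ∷ [] , i).
  forward (resume-step {γ = γ} {w} {i} mem Val≡) (idle , Π)
    with pick-at Π (plus-indicator-nonzero (x ≟Loc x) refl (Val≡ x))
    where
    x : Loc (suc n)
    x = γ ∷ w , i
  ... | (just _ , _) , refl , pending-with L occ-split cnt-split =
    (_ , cnt L) ,
    fire-step mem fire-resume (Equivalence.to (moves-down _ (resume-disp γ)) cnt-split) ,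
    running-γ ,
    pending L (λ y → ℕ.+-cancelʳ-≡ _ _ _ (trans (≡.sym (Val≡ y)) (occ-split y))) (λ j → refl)

  backward-firing : ∀ {c p u p' u'} → Sim c (p , u) → Firing p u p' u' →
                    Σ (Config k (suc n)) λ c' → Step M c c' × Sim c' (p' , u')
  backward-firing {_ , _ , Val} (running-γ {i = i} , Π)
                  (firing {create _ _ _ _ α} mem fire-create disp) =
    _ , create-step mem (λ y → refl) ,
    running (short (bounded mem)) ,
    pending-spawn (spawned α i) Π (λ y → cong (λ z → Val y + z) (spawned-occ α i y))
      (Equivalence.from (moves-up _ (spawned-cnt α i)) disp)
  backward-firing {_ , _ , Val} (running-γ {i = i} , Π)
                  (firing {interrupt _ _ _ w} mem fire-interrupt disp) =
    _ , interrupt-step mem (λ y → refl) ,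
    idle ,
    pending-spawn (interrupted s (suc i) ∷ []) Π
      (λ y → cong (λ z → Val y + z) (interrupted-occ s (suc i) y))
      (Equivalence.from (moves-up _ (interrupted-cnt s (suc i))) disp)
    where
    s : Short w
    s = short (bounded mem)
  -- Counter γ is non-zero, so some pending thread has top symbol γ; it is resumed.
  backward-firing {u = u} {u' = u'} (idle , Π) (firing {resume _ _ γ} mem fire-resume disp)
    with pick-counter Π
           (plus-indicator-nonzero (inject₁ γ Fin.≟ inject₁ γ) refl (u≡ (inject₁ γ)))
    where
    u≡ : ∀ j → u j ≡ u' j + ⟦ inject₁ γ Fin.≟ j ⟧
    u≡ = Equivalence.from (moves-down _ (resume-disp γ)) disp
  ... | (nothing , _) , fromℕ≡inject₁ , _ = ⊥-elim (Fin.fromℕ≢inject₁ fromℕ≡inject₁)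
  ... | (just γ' , _) , inject₁≡ , pending-with L occ-split cnt-split
    with refl ← Fin.inject₁-injective {i = γ'} {j = γ} inject₁≡ =
    _ , resume-step mem occ-split ,
    running-γ ,
    pending L (λ y → refl) (λ j → ℕ.+-cancelʳ-≡ _ _ _ (trans (≡.sym (u≡ j)) (cnt-split j)))
    where
    u≡ : ∀ j → u j ≡ u' j + ⟦ inject₁ γ' Fin.≟ j ⟧
    u≡ = Equivalence.from (moves-down _ (resume-disp γ')) disp

  backward : ∀ {c v v'} → Sim c v → VS v v' → Live v' →
             Σ (Config k (suc n)) λ c' → Step M c c' × Sim c' v'
  backward sim step live = backward-firing sim (step-firing step live)

  initial : γ₀ M ≡ zero → Sim (initConfig M) (⟨ q₀ M , bot ⟩ , 𝐮₀)
  initial γ₀≡0 = idle , pending ((just (γ₀ M) , 0) ∷ [])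
    (λ y → ≡.sym (ℕ.+-identityʳ _))
    (λ j → trans (𝐮₀-unit j) (≡.sym (ℕ.+-identityʳ _)))
    where
    𝐮₀-unit : ∀ j → 𝐮₀ j ≡ ⟦ inject₁ (γ₀ M) Fin.≟ j ⟧
    𝐮₀-unit zero    rewrite γ₀≡0 = refl
    𝐮₀-unit (Fin.suc j) rewrite γ₀≡0 = refl

lemma3p5 : ∀ {k n : ℕ} (M : DCPS k (suc n)) → IsDCFS M → γ₀ M ≡ zero →
    (q : Fin k) → DCPSReachable M q ⇔ VASSReachable (VASSof M) ⟨ q , bot ⟩
lemma3p5 M dcfs γ₀≡0 q = mk⇔ reach-V reach-M
  where
  open Simulation M dcfs
  reach-V : DCPSReachable M q → VASSReachable (VASSof M) ⟨ q , bot ⟩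
  reach-V (Val , run) with simulate-forward Sim forward run (initial γ₀≡0)
  ... | (_ , u) , vrun , (idle , _) = u , vrun
  reach-M : VASSReachable (VASSof M) ⟨ q , bot ⟩ → DCPSReachable M q
  -- The implicit arguments of halt-trap and backward are passed on explicitly,
  -- since VS unfolds to a Σ-type from which Agda cannot recover them.
  reach-M (u , vrun)
    with simulate-backward Sim Live (λ {v} {v'} → halt-trap {v} {v'})
           (λ {c} {v} {v'} → backward {c} {v} {v'}) (initial γ₀≡0) vrun (λ ())
  ... | (_ , nothing , Val) , run , (idle , _) = Val , run
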